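{- For every nested sequent $\Gamma$: if $\Gamma$ is provable in $\mathsf{GLP_{NS}}$, then $\Gamma^\ast$ is provable in $\mathsf{J_{NS}}+\mathsf{weak}+\mathsf{cont}$.
   Context: Formulas are built from atoms $p$, complements $\overline{p}$, $\top,\bot$, $\wedge,\vee$, and $\Box_i,\Diamond_i$ ($i\in\mathbb{N}$); negation $\overline{A}$ is defined via De Morgan laws, $\overline{\overline{p}}=p$, $\overline{\top}=\bot$, $\overline{\bot}=\top$, $\overline{\Box_iA}=\Diamond_i\overline{A}$, $\overline{\Diamond_iA}=\Box_i\overline{A}$. A nested sequent is (inductively) a finite multiset of formulas and of expressions $[\Delta]_i$ with $\Delta$ a nested sequent and $i\in\mathbb{N}$; its formula interpretation is $\Gamma^\sharp:=\bot$ if $\Gamma$ is empty, otherwise the disjunction of its formulas $A_1,\dots,A_n$ and of $\Box_{i_k}\Delta_k^\sharp$ for its members $[\Delta_k]_{i_k}$. The corresponding tree of a sequent has nodes labelled by multisets of formulas (the formulas at that nesting level) and edges labelled by the bracket indices. A unary context $\Gamma\{\ \}$ is a nested sequent with one hole in place of a formula; $\Gamma\{\Upsilon\}$ fills it with $\Upsilon$, $\Gamma\{\emptyset\}$ with the empty sequent. $\mathsf{GLP_{NS}}$ has initial sequents $\Gamma\{p,\overline{p}\}$, $\Gamma\{\top\}$ and rules (premises / conclusion): ($\wedge$) $\Gamma\{A\}$, $\Gamma\{B\}$ / $\Gamma\{A\wedge B\}$; ($\vee$) $\Gamma\{A,B\}$ / $\Gamma\{A\vee B\}$; ($\Box$)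 $\Gamma\{[A,\Diamond_i\overline{A}]_i\}$ / $\Gamma\{\Box_iA\}$; ($\Diamond$) $\Gamma\{\Diamond_iA,[A,\Delta]_j\}$ / $\Gamma\{\Diamond_iA,[\Delta]_j\}$ ($i\le j$); ($\mathsf{tran}$) $\Gamma\{\Diamond_iA,[\Diamond_iA,\Delta]_j\}$ / $\Gamma\{\Diamond_iA,[\Delta]_j\}$ ($i\le j$); ($\mathsf{eucl}$) $\Gamma\{\Diamond_iA,[\Diamond_iA,\Delta]_j\}$ / $\Gamma\{[\Diamond_iA,\Delta]_j\}$ ($i<j$). $\mathsf{J_{NS}}$ has the same initial sequents and rules $\wedge$, $\vee$, $\Box$, $\mathsf{tran}$, $\mathsf{eucl}$, but instead of $\Diamond$ it has ($\Diamond'$) $\Gamma\{\Diamond_iA,[A,\Delta]_i\}$ / $\Gamma\{\Diamond_iA,[\Delta]_i\}$, and additionally ($\mathsf{tran}'$) $\Gamma\{\Diamond_iA,[\Diamond_jA,\Delta]_i\}$ / $\Gamma\{\Diamond_iA,[\Delta]_i\}$ for $i\le j$. $\mathsf{weak}$ is the rule $\Gamma\{\emptyset\}$ / $\Gamma\{\Delta\}$ and $\mathsf{cont}$ is contraction $\Gamma\{A,A\}$ / $\Gamma\{A\}$. For a sequent $\Gamma$, $m(\Gamma)$ is the largest index $i$ of a modality occurring in $\Gamma^\sharp$ ($-1$ if none). $W(\Gamma)$ is the set of formulas $\Box_{i_k}A_k\wedge\overline{\Box_jA_k}$ for all subformulas $\Box_{i_k}A_k$ of $\Gamma^\sharp$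 or of $\overline{\Gamma^\sharp}$ of the form $\Box_iB$ and all $j$ with $i_k<j\le m(\Gamma)$; $\Diamond_iW(\Gamma):=\{\Diamond_iB: B\in W(\Gamma)\}$; $W^+(\Gamma):=W(\Gamma)\cup\bigcup_{i\le m(\Gamma)}\Diamond_iW(\Gamma)$. $\Gamma^\ast$ is the sequent obtained from $\Gamma$ by adding the multiset $W^+(\Gamma)$ to the multiset of formulas at every node of the corresponding tree of $\Gamma$. -}

module Defs where

open import Data.Nat using (ℕ; zero; suc; _+_; _∸_; _⊔_; _≤_; _<_; _≡ᵇ_)
open import Data.Bool using (Bool; true; false; _∧_)
open import Data.List using (List; []; _∷_; _++_; map; concatMap; upTo; deduplicateᵇ)
open import Data.Product using (_×_; _,_)

infixr 6 _∧'_
infixr 5 _∨'_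

-- Formulas in negation normal form

data Fml : Set where
  atom  : ℕ → Fml
  natom : ℕ → Fml
  top   : Fml
  bot   : Fml
  _∧'_  : Fml → Fml → Fml
  _∨'_  : Fml → Fml → Fml
  □     : ℕ → Fml → Fml
  ◇     : ℕ → Fml → Fml

neg : Fml → Fml
neg (atom p)  = natom p
neg (natom p) = atom p
neg top       = bot
neg bot       = top
neg (A ∧' B)  = neg A ∨' neg B
neg (A ∨' B)  = neg A ∧' neg B
neg (□ i A)   = ◇ i (neg A)
neg (◇ i A)   = □ i (neg A)

eqF : Fml → Fml → Bool
eqF (atom p)  (atom q)  = p ≡ᵇ q
eqF (natom p) (natom q) = p ≡ᵇ q
eqF top       top       = true
eqF bot       bot       = true
eqF (A ∧' B)  (C ∧' D)  = eqF A C ∧ eqF B D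
eqF (A ∨' B)  (C ∨' D)  = eqF A C ∧ eqF B D
eqF (□ i A)   (□ j B)   = (i ≡ᵇ j) ∧ eqF A B
eqF (◇ i A)   (◇ j B)   = (i ≡ᵇ j) ∧ eqF A B
eqF _         _         = false

-- Nested sequents: a node is a list (multiset up to the exchange rule
-- below) of items; an item is a formula or a bracket [Δ]_i.

data Item : Set where
  fml : Fml → Item
  box : ℕ → List Item → Item

Seq : Set
Seq = List Item

mutual
  sharp : Seq → Fml
  sharp []       = bot
  sharp (x ∷ []) = itemF x
  sharp (x ∷ y ∷ xs) = itemF x ∨' sharp (y ∷ xs)

  itemF : Item → Fml
  itemF (fml A)   = A
  itemF (box i Δ) = □ i (sharp Δ)

-- Unary contexts Γ{ } : the hole sits at some node between the
-- siblings L and R.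

data Ctx : Set where
  hole : Seq → Seq → Ctx
  node : Seq → ℕ → Ctx → Seq → Ctx

fill : Ctx → Seq → Seq
fill (hole L R)     Υ = L ++ Υ ++ R
fill (node L i C R) Υ = L ++ box i (fill C Υ) ∷ R

-- GLP_NS.  The rule exch makes derivability respect the multiset
-- reading of sequents (it generates nested multiset equality).

data GLP : Seq → Set where
  ax-p  : ∀ C p → GLP (fill C (fml (atom p) ∷ fml (natom p) ∷ []))
  ax-⊤  : ∀ C → GLP (fill C (fml top ∷ []))
  r-∧   : ∀ C A B → GLP (fill C (fml A ∷ [])) → GLP (fill C (fml B ∷ []))
        → GLP (fill C (fml (A ∧' B) ∷ []))
  r-∨   : ∀ C A B → GLP (fill C (fml A ∷ fml B ∷ []))
        → GLP (fill C (fml (A ∨' B) ∷ []))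
  r-□   : ∀ C i A → GLP (fill C (box i (fml A ∷ fml (◇ i (neg A)) ∷ []) ∷ []))
        → GLP (fill C (fml (□ i A) ∷ []))
  r-◇   : ∀ C i j A Δ → i ≤ j
        → GLP (fill C (fml (◇ i A) ∷ box j (fml A ∷ Δ) ∷ []))
        → GLP (fill C (fml (◇ i A) ∷ box j Δ ∷ []))
  r-tran : ∀ C i j A Δ → i ≤ j
        → GLP (fill C (fml (◇ i A) ∷ box j (fml (◇ i A) ∷ Δ) ∷ []))
        → GLP (fill C (fml (◇ i A) ∷ box j Δ ∷ []))
  r-eucl : ∀ C i j A Δ → i < j
        → GLP (fill C (fml (◇ i A) ∷ box j (fml (◇ i A) ∷ Δ) ∷ []))
        → GLP (fill C (box j (fml (◇ i A) ∷ Δ) ∷ []))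
  exch  : ∀ C x y → GLP (fill C (x ∷ y ∷ [])) → GLP (fill C (y ∷ x ∷ []))

data JWC : Seq → Set where
  ax-p  : ∀ C p → JWC (fill C (fml (atom p) ∷ fml (natom p) ∷ []))
  ax-⊤  : ∀ C → JWC (fill C (fml top ∷ []))
  r-∧   : ∀ C A B → JWC (fill C (fml A ∷ [])) → JWC (fill C (fml B ∷ []))
        → JWC (fill C (fml (A ∧' B) ∷ []))
  r-∨   : ∀ C A B → JWC (fill C (fml A ∷ fml B ∷ []))
        → JWC (fill C (fml (A ∨' B) ∷ []))
  r-□   : ∀ C i A → JWC (fill C (box i (fml A ∷ fml (◇ i (neg A)) ∷ []) ∷ []))
        → JWC (fill C (fml (□ i A) ∷ []))
  r-◇'  : ∀ C i A Δ
        → JWC (fill C (fml (◇ i A) ∷ box i (fml A ∷ Δ) ∷ []))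
        → JWC (fill C (fml (◇ i A) ∷ box i Δ ∷ []))
  r-tran : ∀ C i j A Δ → i ≤ j
        → JWC (fill C (fml (◇ i A) ∷ box j (fml (◇ i A) ∷ Δ) ∷ []))
        → JWC (fill C (fml (◇ i A) ∷ box j Δ ∷ []))
  r-tran' : ∀ C i j A Δ → i ≤ j
        → JWC (fill C (fml (◇ i A) ∷ box i (fml (◇ j A) ∷ Δ) ∷ []))
        → JWC (fill C (fml (◇ i A) ∷ box i Δ ∷ []))
  r-eucl : ∀ C i j A Δ → i < j
        → JWC (fill C (fml (◇ i A) ∷ box j (fml (◇ i A) ∷ Δ) ∷ []))
        → JWC (fill C (box j (fml (◇ i A) ∷ Δ) ∷ []))
  weak  : ∀ C Δ → JWC (fill C []) → JWC (fill C Δ)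
  cont  : ∀ C A → JWC (fill C (fml A ∷ fml A ∷ [])) → JWC (fill C (fml A ∷ []))
  exch  : ∀ C x y → JWC (fill C (x ∷ y ∷ [])) → JWC (fill C (y ∷ x ∷ []))

sub : Fml → List Fml
sub (A ∧' B) = (A ∧' B) ∷ sub A ++ sub B
sub (A ∨' B) = (A ∨' B) ∷ sub A ++ sub B
sub (□ i A)  = □ i A ∷ sub A
sub (◇ i A)  = ◇ i A ∷ sub A
sub A        = A ∷ []

-- mplus A = 1 + (largest modal index in A), or 0 if A has no modality
mplus : Fml → ℕ
mplus (A ∧' B) = mplus A ⊔ mplus B
mplus (A ∨' B) = mplus A ⊔ mplus B
mplus (□ i A)  = suc i ⊔ mplus A
mplus (◇ i A)  = suc i ⊔ mplus A
mplus _        = 0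

-- M Γ = m(Γ) + 1 ; so "j ≤ m(Γ)" is "j < M Γ"
M : Seq → ℕ
M Γ = mplus (sharp Γ)

-- for a subformula of the form □_i A: the formulas □_i A ∧ ¬□_j A, i < j ≤ m
wOf : ℕ → Fml → List Fml
wOf m (□ i A) = map (λ k → □ i A ∧' neg (□ (suc i + k) A)) (upTo (m ∸ suc i))
wOf m _       = []

-- W(Γ) as a duplicate-free list (it is a set in the paper)
W : Seq → List Fml
W Γ = deduplicateᵇ eqF
        (concatMap (wOf (M Γ)) (sub (sharp Γ) ++ sub (neg (sharp Γ))))

W⁺ : Seq → List Fml
W⁺ Γ = W Γ ++ concatMap (λ i → map (◇ i) (W Γ)) (upTo (M Γ))

mutual
  addAll : List Fml → Seq → Seq
  addAll ws Γ = map fml ws ++ addItems ws Γ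

  addItems : List Fml → Seq → Seq
  addItems ws []              = []
  addItems ws (fml A ∷ Γ)     = fml A ∷ addItems ws Γ
  addItems ws (box i Δ ∷ Γ)   = box i (addAll ws Δ) ∷ addItems ws Γ

star : Seq → Seq
star Γ = addAll (W⁺ Γ) Γ

module Submission where

-- Fix the root sequent r and write P = W⁺(r), n = m(r) + 1.  We prove, by
-- induction on a GLP_NS-derivation of any sequent Γ all of whose formulas are
-- subformulas of r♯ or of its negation and all of whose brackets have index
-- below n, that the sequent obtained from Γ by adding P to every node is
-- provable in J_NS + weak + cont.  Since P is present at every node, each GLP
-- rule becomes a local step at a node whose remaining items contain P:
--   * ◇ with i = j is ◇'; ◇ with i < j is simulated through the formula
--     □ᵢĀ ∧ ¬□ⱼĀ ∈ W(r) (an identity sequent, ◇' at index j and contraction);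
--   * □ creates a bracket containing a fresh copy of P; each of its formulas
--     is absorbed by ◇', tran or tran' using the copy of W⁺(r) outside;
--   * tran, eucl and the propositional rules translate directly.

open import Defs
open import Data.Nat using (ℕ; suc; _+_; _⊔_; _≤_; _<_; _≡ᵇ_)
open import Data.Nat.Properties
  using (≤-refl; ≤-trans; m≤m⊔n; m≤n⊔m; ≡ᵇ⇒≡; m+[n∸m]≡n; ∸-monoˡ-<; <⇒≤; ≤-<-connex; m≤n⇒m<n∨m≡n)
open import Data.Bool using (T)
open import Data.Bool.Properties using (T-∧)
open import Data.List using (List; []; _∷_; _++_; map; concatMap; upTo)
open import Data.List.Properties using (++-assoc; ++-identityʳ)
open import Data.List.Membership.Propositional using (_∈_)
open import Data.List.Membership.Propositional.Properties
  using (∈-++⁺ˡ; ∈-++⁺ʳ; ∈-++⁻; ∈-map⁺; ∈-map⁻; ∈-concatMap⁺; ∈-concatMap⁻; ∈-upTo⁺; ∈-∃++)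
import Data.List.Membership.Setoid.Properties as SetoidMembership
open import Data.List.Relation.Unary.Any as Any using (here; there)
open import Data.List.Relation.Binary.Permutation.Propositional using (_↭_; refl; prep; swap; trans; ↭-sym)
open import Data.List.Relation.Binary.Permutation.Propositional.Properties using (shift; shifts)
open import Data.Product using (Σ; ∃; _×_; _,_; proj₁; proj₂)
open import Data.Sum using (_⊎_; inj₁; inj₂)
open import Data.Unit using (⊤; tt)
open import Function.Bundles using (Equivalence)
open import Relation.Nullary.Decidable using (T?)
open import Relation.Binary.PropositionalEquality as Eq
  using (_≡_; refl; sym; cong; cong₂; subst; subst₂)

-- Nodes of a nested sequent and rule application at a node

-- A path to a node, outermost bracket first: into L i p R enters the
-- bracket [ … ]_i whose siblings are L and R.
data Path : Set where
  root : Path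
  into : Seq → ℕ → Path → Seq → Path

plug : Path → Seq → Seq
plug root Z = Z
plug (into L i p R) Z = L ++ box i (plug p Z) ∷ R

at : Path → Seq → Seq → Ctx
at root L K = hole L K
at (into L′ i p R′) L K = node L′ i (at p L K) R′

fill-at : ∀ p L K Υ → fill (at p L K) Υ ≡ plug p (L ++ Υ ++ K)
fill-at root L K Υ = refl
fill-at (into L′ i p R′) L K Υ = cong (λ z → L′ ++ box i z ∷ R′) (fill-at p L K Υ)

deeper : Path → Seq → ℕ → Seq → Path
deeper root L i R = into L i root R
deeper (into L′ i′ p R′) L i R = into L′ i′ (deeper p L i R) R′

plug-deeper : ∀ p L i R Z → plug (deeper p L i R) Z ≡ plug p (L ++ box i Z ∷ R)
plug-deeper root L i R Z = refl
plug-deeper (into L′ i′ p R′) L i R Z = cong (λ z → L′ ++ box i′ z ∷ R′) (plug-deeper p L i R Z)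

infix 4 _⊢_
_⊢_ : Path → Seq → Set
p ⊢ Z = JWC (plug p Z)

intoBox : ∀ p L i R Z → deeper p L i R ⊢ Z → p ⊢ L ++ box i Z ∷ R
intoBox p L i R Z = subst JWC (plug-deeper p L i R Z)

Rule₀ : Seq → Set
Rule₀ Y = ∀ C → JWC (fill C Y)

Rule₁ : Seq → Seq → Set
Rule₁ X Y = ∀ C → JWC (fill C X) → JWC (fill C Y)

Rule₂ : Seq → Seq → Seq → Set
Rule₂ X X′ Y = ∀ C → JWC (fill C X) → JWC (fill C X′) → JWC (fill C Y)

ruleIn : ∀ p L K X Y → Rule₁ X Y → p ⊢ L ++ X ++ K → p ⊢ L ++ Y ++ K
ruleIn p L K X Y rule h =
  subst JWC (fill-at p L K Y) (rule (at p L K) (subst JWC (sym (fill-at p L K X)) h))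

axiomAt : ∀ p K Y → Rule₀ Y → p ⊢ Y ++ K
axiomAt p K Y rule = subst JWC (fill-at p [] K Y) (rule (at p [] K))

ruleAt : ∀ p K X Y → Rule₁ X Y → p ⊢ X ++ K → p ⊢ Y ++ K
ruleAt p = ruleIn p []

ruleAt₂ : ∀ p K X X′ Y → Rule₂ X X′ Y → p ⊢ X ++ K → p ⊢ X′ ++ K → p ⊢ Y ++ K
ruleAt₂ p K X X′ Y rule h h′ =
  subst JWC (fill-at p [] K Y)
    (rule (at p [] K) (subst JWC (sym (fill-at p [] K X)) h) (subst JWC (sym (fill-at p [] K X′)) h′))

weakAt : ∀ p K Υ → p ⊢ K → p ⊢ Υ ++ K
weakAt p K Υ = ruleAt p K [] Υ (λ C → weak C Υ)

exchAt : ∀ p K {x y} → p ⊢ x ∷ y ∷ K → p ⊢ y ∷ x ∷ K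
exchAt p K {x} {y} = ruleAt p K _ _ (λ C → exch C x y)

contAt : ∀ p K A → p ⊢ fml A ∷ fml A ∷ K → p ⊢ fml A ∷ K
contAt p K A = ruleAt p K _ _ (λ C → cont C A)

permIn : ∀ p L K {xs ys} → xs ↭ ys → p ⊢ L ++ xs ++ K → p ⊢ L ++ ys ++ K
permIn p L K refl h = h
permIn p L K {x ∷ xs} {x ∷ ys} (prep x q) h =
  subst (p ⊢_) (++-assoc L (x ∷ []) (ys ++ K))
    (permIn p (L ++ x ∷ []) K q (subst (p ⊢_) (sym (++-assoc L (x ∷ []) (xs ++ K))) h))
permIn p L K {x ∷ y ∷ xs} {y ∷ x ∷ ys} (swap x y q) h =
  ruleIn p L (ys ++ K) _ _ (λ C → exch C x y)
    (subst (p ⊢_) (++-assoc L (x ∷ y ∷ []) (ys ++ K))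
      (permIn p (L ++ x ∷ y ∷ []) K q (subst (p ⊢_) (sym (++-assoc L (x ∷ y ∷ []) (xs ++ K))) h)))
permIn p L K (trans q q′) h = permIn p L K q′ (permIn p L K q h)

permAt : ∀ p {xs ys} → xs ↭ ys → p ⊢ xs → p ⊢ ys
permAt p {xs} {ys} q h =
  subst (p ⊢_) (++-identityʳ ys) (permIn p [] [] q (subst (p ⊢_) (sym (++-identityʳ xs)) h))

permBoxAt : ∀ p L j R {xs ys} → xs ↭ ys → p ⊢ L ++ box j xs ∷ R → p ⊢ L ++ box j ys ∷ R
permBoxAt p L j R {xs} {ys} q h =
  intoBox p L j R ys (permAt (deeper p L j R) q (subst JWC (sym (plug-deeper p L j R xs)) h))

rotate : ∀ {A : Set} (x y z : A) zs → x ∷ y ∷ z ∷ zs ↭ y ∷ z ∷ x ∷ zs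
rotate x y z zs = trans (swap x y refl) (prep y (swap x z refl))

extract : ∀ {x : Item} {K} → x ∈ K → ∃ λ K′ → K ↭ x ∷ K′
extract {x} x∈K with ∈-∃++ x∈K
... | ys , zs , refl = ys ++ zs , shift x ys zs

absorb : ∀ p {F K} → fml F ∈ K → p ⊢ fml F ∷ K → p ⊢ K
absorb p {F} F∈K h with extract F∈K
... | K′ , q = permAt p (↭-sym q) (contAt p K′ F (permAt p (prep _ q) h))

withSide : ∀ p {K a a′} G → fml G ∈ K → Rule₁ (fml G ∷ a ∷ []) (fml G ∷ a′ ∷ []) →
           p ⊢ a ∷ K → p ⊢ a′ ∷ K
withSide p {K} {a} {a′} G G∈K rule h with extract G∈K
... | K′ , q =
  permAt p (↭-sym (trans (prep a′ q) (swap a′ (fml G) refl)))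
    (ruleAt p K′ _ _ rule (permAt p (trans (prep a q) (swap a (fml G) refl)) h))

-- Identity sequents: A, Ā is provable at every node

negneg : ∀ A → neg (neg A) ≡ A
negneg (atom q) = refl
negneg (natom q) = refl
negneg top = refl
negneg bot = refl
negneg (A ∧' B) = cong₂ _∧'_ (negneg A) (negneg B)
negneg (A ∨' B) = cong₂ _∨'_ (negneg A) (negneg B)
negneg (□ i A) = cong (□ i) (negneg A)
negneg (◇ i A) = cong (◇ i) (negneg A)

Identity : Fml → Set
Identity A = ∀ p Z → p ⊢ fml A ∷ fml (neg A) ∷ Z

identity-neg : ∀ {A} → Identity A → Identity (neg A)
identity-neg {A} idA p Z =
  subst (λ X → p ⊢ fml (neg A) ∷ fml X ∷ Z) (sym (negneg A)) (exchAt p Z (idA p Z))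

-- ∧ on A ∧ B, then ∨ on Ā ∨ B̄ in each premise
identity-∧ : ∀ {A B} → Identity A → Identity B → Identity (A ∧' B)
identity-∧ {A} {B} idA idB p Z =
  ruleAt₂ p K _ _ _ (λ C → r-∧ C A B) (exchAt p Z left) (exchAt p Z right)
  where
  K = fml (neg A ∨' neg B) ∷ Z
  left : p ⊢ fml (neg A ∨' neg B) ∷ fml A ∷ Z
  left = ruleAt p (fml A ∷ Z) _ _ (λ C → r-∨ C (neg A) (neg B))
           (permAt p (rotate _ _ _ Z) (idA p (fml (neg B) ∷ Z)))
  right : p ⊢ fml (neg A ∨' neg B) ∷ fml B ∷ Z
  right = ruleAt p (fml B ∷ Z) _ _ (λ C → r-∨ C (neg A) (neg B))
            (permAt p (prep _ (swap _ _ refl)) (weakAt p _ (fml (neg A) ∷ []) (idB p Z)))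

-- dual of the ∧ case, through Ā and B̄
identity-∨ : ∀ {A B} → Identity A → Identity B → Identity (A ∨' B)
identity-∨ {A} {B} idA idB p Z =
  exchAt p Z (subst₂ (λ X Y → p ⊢ fml (neg A ∧' neg B) ∷ fml (X ∨' Y) ∷ Z) (negneg A) (negneg B)
    (identity-∧ (identity-neg idA) (identity-neg idB) p Z))

-- □ opens [A, ◇ᵢĀ]ᵢ, and ◇' moves Ā from ◇ᵢĀ outside into it
identity-□ : ∀ {A} i → Identity A → Identity (□ i A)
identity-□ {A} i idA p Z =
  ruleAt p (fml (◇ i (neg A)) ∷ Z) _ _ (λ C → r-□ C i A)
    (exchAt p Z (ruleAt p Z _ _ (λ C → r-◇' C i (neg A) _)
      (intoBox p L i Z _ (exchAt (deeper p L i Z) L (idA (deeper p L i Z) L)))))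
  where
  L = fml (◇ i (neg A)) ∷ []

-- dual of the □ case, through Ā
identity-◇ : ∀ {A} i → Identity A → Identity (◇ i A)
identity-◇ {A} i idA p Z =
  exchAt p Z (subst (λ X → p ⊢ fml (□ i (neg A)) ∷ fml (◇ i X) ∷ Z) (negneg A)
    (identity-□ i (identity-neg idA) p Z))

identity-atom : ∀ q → Identity (atom q)
identity-atom q p Z = axiomAt p Z _ (λ C → ax-p C q)

identity-top : Identity top
identity-top p Z = axiomAt p (fml bot ∷ Z) _ ax-⊤

identity : ∀ A → Identity A
identity (atom q) = identity-atom q
identity (natom q) = identity-neg (identity-atom q)
identity top = identity-top
identity bot = identity-neg identity-top
identity (A ∧' B) = identity-∧ (identity A) (identity B)
identity (A ∨' B) = identity-∨ (identity A) (identity B)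
identity (□ i A) = identity-□ i (identity A)
identity (◇ i A) = identity-◇ i (identity A)

-- The GLP ◇-rule into a bracket of index j is derivable in J_NS + cont when
-- the node contains □ᵢĀ ∧ ¬□ⱼĀ (the formula W(Γ) provides for i < j).
◇-via-witness : ∀ p K i j A B → fml (□ i (neg A) ∧' ◇ j (neg (neg A))) ∈ K →
                p ⊢ fml (◇ i A) ∷ box j (fml A ∷ B) ∷ K → p ⊢ fml (◇ i A) ∷ box j B ∷ K
◇-via-witness p K i j A B w∈K h =
  absorb p (there (there w∈K))
    (ruleAt₂ p (a ∷ b ∷ K) _ _ _ (λ C → r-∧ C _ _) refute-◇ᵢ reach-◇ⱼ)
  where
  a = fml (◇ i A)
  b = box j B
  refute-◇ᵢ : p ⊢ fml (□ i (neg A)) ∷ a ∷ b ∷ K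
  refute-◇ᵢ = subst (λ X → p ⊢ fml (□ i (neg A)) ∷ fml (◇ i X) ∷ b ∷ K) (negneg A)
                (identity (□ i (neg A)) p (b ∷ K))
  reach-◇ⱼ : p ⊢ fml (◇ j (neg (neg A))) ∷ a ∷ b ∷ K
  reach-◇ⱼ = subst (λ X → p ⊢ fml (◇ j X) ∷ a ∷ b ∷ K) (sym (negneg A))
    (permAt p (prep _ (swap b a refl))
      (ruleAt p (a ∷ K) _ _ (λ C → r-◇' C j A B)
        (permAt p (prep _ (swap a _ refl)) (weakAt p _ (fml (◇ j A) ∷ []) h))))

sub-self : ∀ A → A ∈ sub A
sub-self (atom q) = here refl
sub-self (natom q) = here refl
sub-self top = here refl
sub-self bot = here refl
sub-self (A ∧' B) = here refl
sub-self (A ∨' B) = here refl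
sub-self (□ i A) = here refl
sub-self (◇ i A) = here refl

sub-trans : ∀ {B A} C → B ∈ sub A → A ∈ sub C → B ∈ sub C
sub-trans (atom q) b (here refl) = b
sub-trans (natom q) b (here refl) = b
sub-trans top b (here refl) = b
sub-trans bot b (here refl) = b
sub-trans (C ∧' D) b (here refl) = b
sub-trans (C ∧' D) b (there a) with ∈-++⁻ (sub C) a
... | inj₁ a∈C = there (∈-++⁺ˡ (sub-trans C b a∈C))
... | inj₂ a∈D = there (∈-++⁺ʳ (sub C) (sub-trans D b a∈D))
sub-trans (C ∨' D) b (here refl) = b
sub-trans (C ∨' D) b (there a) with ∈-++⁻ (sub C) a
... | inj₁ a∈C = there (∈-++⁺ˡ (sub-trans C b a∈C))
... | inj₂ a∈D = there (∈-++⁺ʳ (sub C) (sub-trans D b a∈D))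
sub-trans (□ i C) b (here refl) = b
sub-trans (□ i C) b (there a) = there (sub-trans C b a)
sub-trans (◇ i C) b (here refl) = b
sub-trans (◇ i C) b (there a) = there (sub-trans C b a)

sub-neg : ∀ {A} C → A ∈ sub C → neg A ∈ sub (neg C)
sub-neg (atom q) (here refl) = here refl
sub-neg (natom q) (here refl) = here refl
sub-neg top (here refl) = here refl
sub-neg bot (here refl) = here refl
sub-neg (C ∧' D) (here refl) = here refl
sub-neg (C ∧' D) (there a) with ∈-++⁻ (sub C) a
... | inj₁ a∈C = there (∈-++⁺ˡ (sub-neg C a∈C))
... | inj₂ a∈D = there (∈-++⁺ʳ (sub (neg C)) (sub-neg D a∈D))
sub-neg (C ∨' D) (here refl) = here refl
sub-neg (C ∨' D) (there a) with ∈-++⁻ (sub C) a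
... | inj₁ a∈C = there (∈-++⁺ˡ (sub-neg C a∈C))
... | inj₂ a∈D = there (∈-++⁺ʳ (sub (neg C)) (sub-neg D a∈D))
sub-neg (□ i C) (here refl) = here refl
sub-neg (□ i C) (there a) = there (sub-neg C a)
sub-neg (◇ i C) (here refl) = here refl
sub-neg (◇ i C) (there a) = there (sub-neg C a)

mplus-sub : ∀ {B} A → B ∈ sub A → mplus B ≤ mplus A
mplus-sub (atom q) (here refl) = ≤-refl
mplus-sub (natom q) (here refl) = ≤-refl
mplus-sub top (here refl) = ≤-refl
mplus-sub bot (here refl) = ≤-refl
mplus-sub (C ∧' D) (here refl) = ≤-refl
mplus-sub (C ∧' D) (there a) with ∈-++⁻ (sub C) a
... | inj₁ a∈C = ≤-trans (mplus-sub C a∈C) (m≤m⊔n _ _)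
... | inj₂ a∈D = ≤-trans (mplus-sub D a∈D) (m≤n⊔m _ _)
mplus-sub (C ∨' D) (here refl) = ≤-refl
mplus-sub (C ∨' D) (there a) with ∈-++⁻ (sub C) a
... | inj₁ a∈C = ≤-trans (mplus-sub C a∈C) (m≤m⊔n _ _)
... | inj₂ a∈D = ≤-trans (mplus-sub D a∈D) (m≤n⊔m _ _)
mplus-sub (□ i C) (here refl) = ≤-refl
mplus-sub (□ i C) (there a) = ≤-trans (mplus-sub C a) (m≤n⊔m _ _)
mplus-sub (◇ i C) (here refl) = ≤-refl
mplus-sub (◇ i C) (there a) = ≤-trans (mplus-sub C a) (m≤n⊔m _ _)

mplus-neg : ∀ A → mplus (neg A) ≡ mplus A
mplus-neg (atom q) = refl
mplus-neg (natom q) = refl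
mplus-neg top = refl
mplus-neg bot = refl
mplus-neg (A ∧' B) = cong₂ _⊔_ (mplus-neg A) (mplus-neg B)
mplus-neg (A ∨' B) = cong₂ _⊔_ (mplus-neg A) (mplus-neg B)
mplus-neg (□ i A) = cong (suc i ⊔_) (mplus-neg A)
mplus-neg (◇ i A) = cong (suc i ⊔_) (mplus-neg A)

-- Sequents built from the subformulas of a fixed formula R and its negation

module Bounded (R : Fml) where

  n : ℕ
  n = mplus R

  S : List Fml
  S = sub R ++ sub (neg R)

  S-sub : ∀ {A B} → A ∈ S → B ∈ sub A → B ∈ S
  S-sub {A} a b with ∈-++⁻ (sub R) a
  ... | inj₁ a∈R = ∈-++⁺ˡ (sub-trans R b a∈R)
  ... | inj₂ a∈R̄ = ∈-++⁺ʳ (sub R) (sub-trans (neg R) b a∈R̄)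

  S-neg : ∀ {A} → A ∈ S → neg A ∈ S
  S-neg {A} a with ∈-++⁻ (sub R) a
  ... | inj₁ a∈R = ∈-++⁺ʳ (sub R) (sub-neg R a∈R)
  ... | inj₂ a∈R̄ = ∈-++⁺ˡ (subst (λ X → neg A ∈ sub X) (negneg R) (sub-neg (neg R) a∈R̄))

  S-bound : ∀ {A} → A ∈ S → mplus A ≤ n
  S-bound {A} a with ∈-++⁻ (sub R) a
  ... | inj₁ a∈R = mplus-sub R a∈R
  ... | inj₂ a∈R̄ = subst (mplus A ≤_) (mplus-neg R) (mplus-sub (neg R) a∈R̄)

  S-∧ : ∀ {A B} → (A ∧' B) ∈ S → A ∈ S × B ∈ S
  S-∧ {A} {B} a = S-sub a (there (∈-++⁺ˡ (sub-self A))) , S-sub a (there (∈-++⁺ʳ (sub A) (sub-self B)))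

  S-∨ : ∀ {A B} → (A ∨' B) ∈ S → A ∈ S × B ∈ S
  S-∨ {A} {B} a = S-sub a (there (∈-++⁺ˡ (sub-self A))) , S-sub a (there (∈-++⁺ʳ (sub A) (sub-self B)))

  S-□ : ∀ {i A} → □ i A ∈ S → A ∈ S
  S-□ {i} {A} a = S-sub a (there (sub-self A))

  S-◇ : ∀ {i A} → ◇ i A ∈ S → A ∈ S
  S-◇ {i} {A} a = S-sub a (there (sub-self A))

  S-□-index : ∀ {i A} → □ i A ∈ S → i < n
  S-□-index {i} {A} a = ≤-trans (m≤m⊔n (suc i) (mplus A)) (S-bound a)

  Good : Seq → Set
  Good [] = ⊤
  Good (fml A ∷ xs) = (A ∈ S) × Good xs
  Good (box i Δ ∷ xs) = (i < n) × Good Δ × Good xs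

  good-split : ∀ xs {ys} → Good (xs ++ ys) → Good xs × Good ys
  good-split [] g = tt , g
  good-split (fml A ∷ xs) (a , g) with good-split xs g
  ... | g₁ , g₂ = (a , g₁) , g₂
  good-split (box i Δ ∷ xs) (i<n , d , g) with good-split xs g
  ... | g₁ , g₂ = (i<n , d , g₁) , g₂

  good-++ : ∀ xs {ys} → Good xs → Good ys → Good (xs ++ ys)
  good-++ [] g h = h
  good-++ (fml A ∷ xs) (a , g) h = a , good-++ xs g h
  good-++ (box i Δ ∷ xs) (i<n , d , g) h = i<n , d , good-++ xs g h

  good-swap : ∀ x y → Good (x ∷ y ∷ []) → Good (y ∷ x ∷ [])
  good-swap (fml A) (fml B) (a , b , _) = b , a , tt
  good-swap (fml A) (box i Δ) (a , i<n , d , _) = i<n , d , a , tt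
  good-swap (box j Δ′) (fml B) (j<n , d′ , b , _) = b , j<n , d′ , tt
  good-swap (box j Δ′) (box i Δ) (j<n , d′ , i<n , d , _) = i<n , d , j<n , d′ , tt

  good-out : ∀ C X → Good (fill C X) → Good X
  good-out (hole L R) X g = proj₁ (good-split X (proj₂ (good-split L g)))
  good-out (node L i C R) X g = good-out C X (proj₁ (proj₂ (proj₂ (good-split L g))))

  good-in : ∀ C X Y → Good (fill C X) → Good Y → Good (fill C Y)
  good-in (hole L R) X Y g h with good-split L g
  ... | gL , g′ = good-++ L gL (good-++ Y h (proj₂ (good-split X g′)))
  good-in (node L i C R) X Y g h with good-split L g
  ... | gL , (i<n , d , gR) = good-++ L gL (i<n , good-in C X Y d h , gR)

  good-root : ∀ Γ → (∀ {B} → B ∈ sub (sharp Γ) → B ∈ S) → mplus (sharp Γ) ≤ n → Good Γ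
  good-root [] _ _ = tt
  good-root (fml A ∷ []) inS _ = inS (sub-self A) , tt
  good-root (box i Δ ∷ []) inS bd =
    ≤-trans (m≤m⊔n (suc i) (mplus (sharp Δ))) bd ,
    good-root Δ (λ b → inS (there b)) (≤-trans (m≤n⊔m (suc i) (mplus (sharp Δ))) bd) , tt
  good-root (fml A ∷ y ∷ xs) inS bd =
    inS (there (∈-++⁺ˡ (sub-self A))) ,
    good-root (y ∷ xs) (λ b → inS (there (∈-++⁺ʳ (sub A) b))) (≤-trans (m≤n⊔m (mplus A) _) bd)
  good-root (box i Δ ∷ y ∷ xs) inS bd =
    ≤-trans (m≤m⊔n (suc i) (mplus (sharp Δ))) head-bd ,
    good-root Δ (λ b → inS (there (∈-++⁺ˡ (there b)))) (≤-trans (m≤n⊔m (suc i) (mplus (sharp Δ))) head-bd) ,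
    good-root (y ∷ xs) (λ b → inS (there (∈-++⁺ʳ (sub (□ i (sharp Δ))) b)))
      (≤-trans (m≤n⊔m (suc i ⊔ mplus (sharp Δ)) (mplus (sharp (y ∷ xs)))) bd)
    where
    head-bd : suc i ⊔ mplus (sharp Δ) ≤ n
    head-bd = ≤-trans (m≤m⊔n (suc i ⊔ mplus (sharp Δ)) (mplus (sharp (y ∷ xs)))) bd

addItems-++ : ∀ ws xs ys → addItems ws (xs ++ ys) ≡ addItems ws xs ++ addItems ws ys
addItems-++ ws [] ys = refl
addItems-++ ws (fml A ∷ xs) ys = cong (fml A ∷_) (addItems-++ ws xs ys)
addItems-++ ws (box i Δ ∷ xs) ys = cong (box i (addAll ws Δ) ∷_) (addItems-++ ws xs ys)

addItem : List Fml → Item → Item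
addItem ws (fml A) = fml A
addItem ws (box i Δ) = box i (addAll ws Δ)

addItems-pair : ∀ ws x y → addItems ws (x ∷ y ∷ []) ≡ addItem ws x ∷ addItem ws y ∷ []
addItems-pair ws (fml A) (fml B) = refl
addItems-pair ws (fml A) (box i Δ) = refl
addItems-pair ws (box j Δ′) (fml B) = refl
addItems-pair ws (box j Δ′) (box i Δ) = refl

eqF-sound : ∀ A B → T (eqF A B) → A ≡ B
eqF-sound (atom p) (atom q) t = cong atom (≡ᵇ⇒≡ p q t)
eqF-sound (natom p) (natom q) t = cong natom (≡ᵇ⇒≡ p q t)
eqF-sound top top t = refl
eqF-sound bot bot t = refl
eqF-sound (A ∧' B) (C ∧' D) t with Equivalence.to T-∧ t
... | t₁ , t₂ = cong₂ _∧'_ (eqF-sound A C t₁) (eqF-sound B D t₂)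
eqF-sound (A ∨' B) (C ∨' D) t with Equivalence.to T-∧ t
... | t₁ , t₂ = cong₂ _∨'_ (eqF-sound A C t₁) (eqF-sound B D t₂)
eqF-sound (□ i A) (□ j B) t with Equivalence.to (T-∧ {i ≡ᵇ j}) t
... | t₁ , t₂ = cong₂ □ (≡ᵇ⇒≡ i j t₁) (eqF-sound A B t₂)
eqF-sound (◇ i A) (◇ j B) t with Equivalence.to (T-∧ {i ≡ᵇ j}) t
... | t₁ , t₂ = cong₂ ◇ (≡ᵇ⇒≡ i j t₁) (eqF-sound A B t₂)

-- The translation of GLP_NS-derivations, for a fixed root sequent r

module Translation (r : Seq) where
  open Bounded (sharp r)

  P : List Fml
  P = W⁺ r

  [P] : Seq
  [P] = map fml P

  Contains : Seq → Set
  Contains K = ∀ {F} → F ∈ P → fml F ∈ K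

  W⊆P : ∀ {F} → F ∈ W r → F ∈ P
  W⊆P = ∈-++⁺ˡ

  ◇W⊆P : ∀ {F k} → F ∈ W r → k < n → ◇ k F ∈ P
  ◇W⊆P {F} {k} F∈W k<n =
    ∈-++⁺ʳ (W r) (∈-concatMap⁺ (λ i → map (◇ i) (W r)) (Any.map (λ { refl → ∈-map⁺ (◇ k) F∈W }) (∈-upTo⁺ k<n)))

  P-cases : ∀ {F} → F ∈ P → F ∈ W r ⊎ ∃ λ k → ∃ λ w → F ≡ ◇ k w × w ∈ W r
  P-cases F∈P with ∈-++⁻ (W r) F∈P
  ... | inj₁ F∈W = inj₁ F∈W
  ... | inj₂ F∈◇W with Any.satisfied (∈-concatMap⁻ (λ i → map (◇ i) (W r)) {xs = upTo n} F∈◇W)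
  ... | k , F∈◇ₖW with ∈-map⁻ (◇ k) F∈◇ₖW
  ... | w , w∈W , refl = inj₂ (k , w , refl , w∈W)

  -- the witness of W(r) needed to simulate the GLP ◇-rule for i < j
  witness∈W : ∀ {i j A} → ◇ i A ∈ S → i < j → j < n → (□ i (neg A) ∧' ◇ j (neg (neg A))) ∈ W r
  witness∈W {i} {j} {A} ◇A∈S i<j j<n =
    SetoidMembership.∈-deduplicate⁺ (Eq.setoid Fml) (λ x y → T? (eqF x y))
      (λ t e → Eq.trans e (sym (eqF-sound _ _ t)))
      (∈-concatMap⁺ (wOf n) (Any.map (λ { refl → in-wOf }) (S-neg ◇A∈S)))
    where
    in-wOf : (□ i (neg A) ∧' ◇ j (neg (neg A))) ∈ wOf n (□ i (neg A))
    in-wOf = subst (λ m → (□ i (neg A) ∧' ◇ m (neg (neg A))) ∈ wOf n (□ i (neg A))) (m+[n∸m]≡n i<j)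
               (∈-map⁺ (λ k → □ i (neg A) ∧' neg (□ (suc i + k) (neg A))) (∈-upTo⁺ (∸-monoˡ-< j<n i<j)))

  -- In the translation of C{Υ}, the translation of Υ sits at a node that
  -- already holds P in front of the translated siblings L and R of the hole.
  locate : ∀ C → Σ Path λ p → Σ Seq λ L → Σ Seq λ R →
           ∀ Υ → addAll P (fill C Υ) ≡ plug p (([P] ++ L) ++ addItems P Υ ++ R)
  locate (hole L R) = root , addItems P L , addItems P R , λ Υ → begin
      [P] ++ addItems P (L ++ Υ ++ R)
    ≡⟨ cong ([P] ++_) (Eq.trans (addItems-++ P L (Υ ++ R)) (cong (addItems P L ++_) (addItems-++ P Υ R))) ⟩
      [P] ++ addItems P L ++ addItems P Υ ++ addItems P R
    ≡⟨ sym (++-assoc [P] (addItems P L) _) ⟩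
      ([P] ++ addItems P L) ++ addItems P Υ ++ addItems P R ∎
    where open Eq.≡-Reasoning
  locate (node L i C R) with locate C
  ... | p , L′ , R′ , eq = into ([P] ++ addItems P L) i p (addItems P R) , L′ , R′ , λ Υ → begin
      [P] ++ addItems P (L ++ box i (fill C Υ) ∷ R)
    ≡⟨ cong ([P] ++_) (addItems-++ P L (box i (fill C Υ) ∷ R)) ⟩
      [P] ++ addItems P L ++ box i (addAll P (fill C Υ)) ∷ addItems P R
    ≡⟨ sym (++-assoc [P] (addItems P L) _) ⟩
      ([P] ++ addItems P L) ++ box i (addAll P (fill C Υ)) ∷ addItems P R
    ≡⟨ cong (λ z → ([P] ++ addItems P L) ++ box i z ∷ addItems P R) (eq Υ) ⟩
      ([P] ++ addItems P L) ++ box i (plug p (([P] ++ L′) ++ addItems P Υ ++ R′)) ∷ addItems P R ∎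
    where open Eq.≡-Reasoning

  -- Hence a rule instance in C{ } can be treated at the front of a node
  -- whose remaining items contain P.
  record Site (C : Ctx) : Set where
    field
      path : Path
      rest : Seq
      rest-contains : Contains rest
      enter : ∀ X → JWC (addAll P (fill C X)) → path ⊢ addItems P X ++ rest
      leave : ∀ X → path ⊢ addItems P X ++ rest → JWC (addAll P (fill C X))

  site : ∀ C → Site C
  site C with locate C
  ... | p , L , R , eq = record
    { path = p
    ; rest = ([P] ++ L) ++ R
    ; rest-contains = λ F∈P → ∈-++⁺ˡ (∈-++⁺ˡ (∈-map⁺ fml F∈P))
    ; enter = λ X h → permAt p (shifts ([P] ++ L) (addItems P X)) (subst JWC (eq X) h)
    ; leave = λ X h → subst JWC (sym (eq X)) (permAt p (shifts (addItems P X) ([P] ++ L)) h)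
    }

  Step : Seq → Seq → Set
  Step Y X = ∀ p K → Contains K → p ⊢ addItems P Y ++ K → p ⊢ addItems P X ++ K

  conclude₀ : ∀ C X → (∀ p K → p ⊢ addItems P X ++ K) → JWC (addAll P (fill C X))
  conclude₀ C X step = leave X (step path rest)
    where open Site (site C)

  conclude₁ : ∀ C Y X → Step Y X → JWC (addAll P (fill C Y)) → JWC (addAll P (fill C X))
  conclude₁ C Y X step h = leave X (step path rest rest-contains (enter Y h))
    where open Site (site C)

  conclude₂ : ∀ C Y Y′ X → (∀ p K → p ⊢ addItems P Y ++ K → p ⊢ addItems P Y′ ++ K → p ⊢ addItems P X ++ K) →
              JWC (addAll P (fill C Y)) → JWC (addAll P (fill C Y′)) → JWC (addAll P (fill C X))
  conclude₂ C Y Y′ X step h h′ = leave X (step path rest (enter Y h) (enter Y′ h′))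
    where open Site (site C)

  -- a formula of P can be dropped from a bracket [ ]ᵢ with i < n, using
  -- ◇', tran or tran' with a formula of W⁺(r) present outside it
  drop-from-box : ∀ p K i Δ {F} → Contains K → i < n → F ∈ P →
                  p ⊢ box i (fml F ∷ Δ) ∷ K → p ⊢ box i Δ ∷ K
  drop-from-box p K i Δ {F} K⊇P i<n F∈P h with P-cases F∈P
  ... | inj₁ F∈W = withSide p (◇ i F) (K⊇P (◇W⊆P F∈W i<n)) (λ C → r-◇' C i F Δ) h
  ... | inj₂ (k , w , refl , w∈W) with ≤-<-connex k i
  ...   | inj₁ k≤i = withSide p (◇ k w) (K⊇P F∈P) (λ C → r-tran C k i w Δ k≤i) h
  ...   | inj₂ i<k = withSide p (◇ i w) (K⊇P (◇W⊆P w∈W i<n)) (λ C → r-tran' C i k w Δ (<⇒≤ i<k)) h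

  drop-all-from-box : ∀ p K i Δ Q → Contains K → i < n → (∀ {F} → F ∈ Q → F ∈ P) →
                      p ⊢ box i (map fml Q ++ Δ) ∷ K → p ⊢ box i Δ ∷ K
  drop-all-from-box p K i Δ [] K⊇P i<n Q⊆P h = h
  drop-all-from-box p K i Δ (F ∷ Q) K⊇P i<n Q⊆P h =
    drop-all-from-box p K i Δ Q K⊇P i<n (λ F∈Q → Q⊆P (there F∈Q))
      (drop-from-box p K i (map fml Q ++ Δ) K⊇P i<n (Q⊆P (here refl)) h)

  -- the copy of P in the new bracket created by □ is dropped again
  □-step : ∀ i A → i < n → Step (box i (fml A ∷ fml (◇ i (neg A)) ∷ []) ∷ []) (fml (□ i A) ∷ [])
  □-step i A i<n p K K⊇P h =
    ruleAt p K _ _ (λ C → r-□ C i A) (drop-all-from-box p K i _ P K⊇P i<n (λ F∈P → F∈P) h)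

  to-front : ∀ p L j K x Δ → p ⊢ L ++ box j ([P] ++ x ∷ Δ) ∷ K → p ⊢ L ++ box j (x ∷ [P] ++ Δ) ∷ K
  to-front p L j K x Δ = permBoxAt p L j K (shift x [P] Δ)

  from-front : ∀ p L j K x Δ → p ⊢ L ++ box j (x ∷ [P] ++ Δ) ∷ K → p ⊢ L ++ box j ([P] ++ x ∷ Δ) ∷ K
  from-front p L j K x Δ = permBoxAt p L j K (↭-sym (shift x [P] Δ))

  -- GLP ◇: ◇' when i = j, and the witness of W(r) when i < j
  ◇-step : ∀ i j A Δ → i ≤ j → ◇ i A ∈ S → j < n →
           Step (fml (◇ i A) ∷ box j (fml A ∷ Δ) ∷ []) (fml (◇ i A) ∷ box j Δ ∷ [])
  ◇-step i j A Δ i≤j ◇A∈S j<n p K K⊇P h =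
    simulate-◇ (to-front p (fml (◇ i A) ∷ []) j K (fml A) (addItems P Δ) h)
    where
    simulate-◇ : ∀ {B} → p ⊢ fml (◇ i A) ∷ box j (fml A ∷ B) ∷ K → p ⊢ fml (◇ i A) ∷ box j B ∷ K
    simulate-◇ {B} with m≤n⇒m<n∨m≡n i≤j
    ... | inj₂ refl = ruleAt p K _ _ (λ C → r-◇' C i A B)
    ... | inj₁ i<j = ◇-via-witness p K i j A B (K⊇P (W⊆P (witness∈W ◇A∈S i<j j<n)))

  -- tran and eucl are rules of J_NS; only the bracket contents are reordered
  tran-step : ∀ i j A Δ → i ≤ j →
              Step (fml (◇ i A) ∷ box j (fml (◇ i A) ∷ Δ) ∷ []) (fml (◇ i A) ∷ box j Δ ∷ [])
  tran-step i j A Δ i≤j p K _ h =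
    ruleAt p K _ _ (λ C → r-tran C i j A ([P] ++ addItems P Δ) i≤j)
      (to-front p (fml (◇ i A) ∷ []) j K (fml (◇ i A)) (addItems P Δ) h)

  eucl-step : ∀ i j A Δ → i < j →
              Step (fml (◇ i A) ∷ box j (fml (◇ i A) ∷ Δ) ∷ []) (box j (fml (◇ i A) ∷ Δ) ∷ [])
  eucl-step i j A Δ i<j p K _ h =
    from-front p [] j K (fml (◇ i A)) (addItems P Δ)
      (ruleAt p K _ _ (λ C → r-eucl C i j A ([P] ++ addItems P Δ) i<j)
        (to-front p (fml (◇ i A) ∷ []) j K (fml (◇ i A)) (addItems P Δ) h))

  exch-step : ∀ x y → Step (x ∷ y ∷ []) (y ∷ x ∷ [])
  exch-step x y p K _ h rewrite addItems-pair P x y | addItems-pair P y x = exchAt p K h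

  -- The translation of every good GLP_NS-provable sequent is provable;
  -- the induction hypothesis applies since premises of good conclusions are good.
  translate : ∀ Γ → GLP Γ → Good Γ → JWC (addAll P Γ)
  translate _ (ax-p C q) _ = conclude₀ C _ (λ p K → axiomAt p K _ (λ C′ → ax-p C′ q))
  translate _ (ax-⊤ C) _ = conclude₀ C _ (λ p K → axiomAt p K _ ax-⊤)
  translate _ (r-∧ C A B d d′) g =
    conclude₂ C _ _ _ (λ p K → ruleAt₂ p K _ _ _ (λ C′ → r-∧ C′ A B))
      (translate _ d (good-in C _ _ g (proj₁ A,B∈S , tt)))
      (translate _ d′ (good-in C _ _ g (proj₂ A,B∈S , tt)))
    where A,B∈S = S-∧ (proj₁ (good-out C _ g))
  translate _ (r-∨ C A B d) g =
    conclude₁ C _ _ (λ p K _ → ruleAt p K _ _ (λ C′ → r-∨ C′ A B))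
      (translate _ d (good-in C _ _ g (proj₁ A,B∈S , proj₂ A,B∈S , tt)))
    where A,B∈S = S-∨ (proj₁ (good-out C _ g))
  translate _ (r-□ C i A d) g =
    conclude₁ C _ _ (□-step i A (S-□-index □A∈S))
      (translate _ d (good-in C _ _ g (S-□-index □A∈S , (S-□ □A∈S , S-neg □A∈S , tt) , tt)))
    where □A∈S = proj₁ (good-out C _ g)
  translate _ (r-◇ C i j A Δ i≤j d) g with good-out C _ g
  ... | ◇A∈S , j<n , gΔ , _ =
    conclude₁ C _ _ (◇-step i j A Δ i≤j ◇A∈S j<n)
      (translate _ d (good-in C _ _ g (◇A∈S , j<n , (S-◇ ◇A∈S , gΔ) , tt)))
  translate _ (r-tran C i j A Δ i≤j d) g with good-out C _ g
  ... | ◇A∈S , j<n , gΔ , _ =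
    conclude₁ C _ _ (tran-step i j A Δ i≤j)
      (translate _ d (good-in C _ _ g (◇A∈S , j<n , (◇A∈S , gΔ) , tt)))
  translate _ (r-eucl C i j A Δ i<j d) g with good-out C _ g
  ... | j<n , (◇A∈S , gΔ) , _ =
    conclude₁ C _ _ (eucl-step i j A Δ i<j)
      (translate _ d (good-in C _ _ g (◇A∈S , j<n , (◇A∈S , gΔ) , tt)))
  translate _ (exch C x y d) g =
    conclude₁ C _ _ (exch-step x y) (translate _ d (good-in C _ _ g (good-swap y x (good-out C _ g))))

lemma21 : (Γ : Seq) → GLP Γ → JWC (star Γ)
lemma21 Γ d = translate Γ d (good-root Γ ∈-++⁺ˡ ≤-refl)
  where open Translation Γ
        open Bounded (sharp Γ) using (good-root)
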